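{- Let $\mathcal{M}=\langle Q,A,\delta\rangle$ be an MDP with $n=|Q|$ states, let $T\subseteq Q$ and let $d_0$ be an initial distribution. If $d_0$ is not sure weakly synchronizing in $T$ (i.e. there is no strategy $\sigma$ such that $\mathcal{M}^{\sigma}_i(T)=1$ for infinitely many $i$), then for every strategy $\sigma$, $\mathcal{M}^{\sigma}_i(T)=1$ holds for at most $2^{n}$ values of $i$.
   Context: An MDP is $\mathcal{M}=\langle Q,A,\delta\rangle$ with $Q$ finite set of states, $A$ finite set of actions, $\delta:Q\times A\to\mathcal{D}(Q)$ probabilistic transition function. A (randomized) strategy is a function $\sigma:(QA)^*Q\to\mathcal{D}(A)$; with initial distribution $d_0$ it induces a probability measure $\Pr^{\sigma}_{d_0}$ on infinite paths in the standard way. $\mathcal{M}^{\sigma}_i(q)=\Pr^{\sigma}_{d_0}(\text{the state at position } i \text{ is } q)$ is the distribution after $i$ steps, and $d(T)=\sum_{q\in T}d(q)$.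
   Formalization: The transition probabilities of δ, the initial distribution $d_0$ and the action distributions chosen by every strategy σ take only rational values. -}

module Defs where

open import Data.Nat using (ℕ; zero; suc)
open import Data.Fin using (Fin; zero; suc; _≟_)
open import Data.Fin.Subset using (Subset)
open import Data.Vec using (lookup)
open import Data.Bool using (Bool; true; false; if_then_else_)
open import Data.Product using (_×_; _,_)
open import Data.Rational using (ℚ; 0ℚ; 1ℚ; _+_; _*_; _≤_)
open import Relation.Binary.PropositionalEquality using (_≡_)
open import Relation.Nullary using (does)

sumFin : ∀ {k} → (Fin k → ℚ) → ℚ
sumFin {zero}  f = 0ℚ
sumFin {suc k} f = f zero + sumFin (λ x → f (suc x))

record Dist (k : ℕ) : Set where
  field
    prob   : Fin k → ℚ
    nonneg : ∀ x → 0ℚ ≤ prob x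
    total  : sumFin prob ≡ 1ℚ
open Dist public

record MDP : Set where
  field
    nQ : ℕ
    nA : ℕ
    δ  : Fin nQ → Fin nA → Dist nQ
open MDP public

-- Histories (QA)^i Q of length i, stored in snoc form.
Hist : MDP → ℕ → Set
Hist M zero    = Fin (nQ M)
Hist M (suc i) = Hist M i × Fin (nA M) × Fin (nQ M)

last : (M : MDP) → ∀ i → Hist M i → Fin (nQ M)
last M zero    q           = q
last M (suc i) (h , a , q) = q

Strategy : MDP → Set
Strategy M = ∀ i → Hist M i → Dist (nA M)

sumHist : (M : MDP) → ∀ i → (Hist M i → ℚ) → ℚ
sumHist M zero    f = sumFin f
sumHist M (suc i) f = sumHist M i (λ h → sumFin (λ a → sumFin (λ q → f (h , a , q))))

-- Probability (under Pr^σ_{d0}) of the cylinder of a history of length i.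
histProb : (M : MDP) → Dist (nQ M) → Strategy M → ∀ i → Hist M i → ℚ
histProb M d0 σ zero    q           = prob d0 q
histProb M d0 σ (suc i) (h , a , q) =
  histProb M d0 σ i h * prob (σ i h) a * prob (δ M (last M i h) a) q

dist : (M : MDP) → Dist (nQ M) → Strategy M → ℕ → Fin (nQ M) → ℚ
dist M d0 σ i q =
  sumHist M i (λ h → if does (last M i h ≟ q) then histProb M d0 σ i h else 0ℚ)

massOn : ∀ {k} → (Fin k → ℚ) → Subset k → ℚ
massOn d T = sumFin (λ q → if lookup T q then d q else 0ℚ)

distT : (M : MDP) → Dist (nQ M) → Strategy M → ℕ → Subset (nQ M) → ℚ
distT M d0 σ i T = massOn (dist M d0 σ i) T

-- Only the support of M^σ_i matters for whether M^σ_i(T) = 1, and there are at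
-- most 2^n supports. So among more than 2^n times i with M^σ_i(T) = 1 two times
-- i < j have the same support. A strategy can then pump the segment [i, j):
-- it plays like σ, and whenever σ's history would reach time j it is swapped
-- for a positive-probability history of time i ending in the same state. Every
-- positive-probability history of the pumped strategy is simulated by one of σ,
-- so at each of the infinitely many returns to time i all the mass lies in T,
-- which makes d0 sure weakly synchronizing in T.
module Submission where

open import Defs
open import Data.Nat using (ℕ; _≤_; _^_)
open import Data.Fin.Subset using (Subset)
open import Data.Product using (Σ-syntax; ∃-syntax; _×_)
open import Data.List using (List; length)
open import Data.List.Relation.Unary.All using (All)
open import Data.List.Relation.Unary.Unique.Propositional using (Unique)
open import Data.Rational using (1ℚ)
open import Relation.Binary.PropositionalEquality using (_≡_)
open import Relation.Nullary using (¬_)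

open import Algebra.Bundles using (Ring)
open import Data.Bool using (true; false; if_then_else_)
open import Data.Fin as Fin using (Fin; zero; suc; funToFin; finToFun)
open import Data.Fin.Properties using (pigeonhole; finToFun-funToFin; any?; 2↔Bool; <⇒≢)
import Data.List as List
open import Data.List.Membership.Propositional.Properties using (∈-lookup)
import Data.List.Relation.Unary.All as All
open import Data.List.Relation.Unary.AllPairs using (_∷_)
open import Data.Nat using (zero; suc; _+_; _<_; z≤n; s≤s)
import Data.Nat.Properties as ℕₚ
open import Data.Product using (∃; ∃₂; _,_)
open import Data.Rational as ℚ using (ℚ; 0ℚ; _*_)
import Data.Rational.Properties as ℚₚ
open import Data.Vec using (lookup)
open import Function using (_∘_; _⇔_; mk⇔; Inverse; Equivalence)
open import Relation.Binary using (tri<; tri≈; tri>)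
open import Relation.Binary.PropositionalEquality
  using (_≢_; refl; sym; trans; cong; cong₂; subst; subst₂; module ≡-Reasoning)
open import Relation.Nullary using (Dec; yes; no; does; contradiction)
open import Relation.Nullary.Decidable using (map′; _×-dec_)

open import Algebra.Properties.Semiring.Sum (Ring.semiring ℚₚ.+-*-ring)
  using (sum; ∑-comm; *-distribˡ-sum; sum-replicate-zero)

open ≡-Reasoning

*-nonNeg : ∀ {x y} → 0ℚ ℚ.≤ x → 0ℚ ℚ.≤ y → 0ℚ ℚ.≤ x * y
*-nonNeg {x} {y} 0≤x 0≤y =
  ℚₚ.nonNegative⁻¹ (x * y)
    {{ℚₚ.nonNeg*nonNeg⇒nonNeg x {{ℚ.nonNegative 0≤x}} y {{ℚ.nonNegative 0≤y}}}}

*-pos : ∀ {x y} → 0ℚ ℚ.< x → 0ℚ ℚ.< y → 0ℚ ℚ.< x * y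
*-pos {x} {y} 0<x 0<y =
  ℚₚ.positive⁻¹ (x * y) {{ℚₚ.pos*pos⇒pos x {{ℚ.positive 0<x}} y {{ℚ.positive 0<y}}}}

*-pos⇒posˡ : ∀ {x y} → 0ℚ ℚ.≤ y → 0ℚ ℚ.< x * y → 0ℚ ℚ.< x
*-pos⇒posˡ {x} {y} 0≤y 0<xy = ℚₚ.≰⇒> λ x≤0 →
  ℚₚ.<-irrefl refl (ℚₚ.<-≤-trans 0<xy (ℚₚ.nonPositive⁻¹ (x * y)
    {{ℚₚ.nonPos*nonNeg⇒nonPos x {{ℚ.nonPositive x≤0}} y {{ℚ.nonNegative 0≤y}}}}))

*-pos⇒posʳ : ∀ {x y} → 0ℚ ℚ.≤ x → 0ℚ ℚ.< x * y → 0ℚ ℚ.< y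
*-pos⇒posʳ {x} {y} 0≤x 0<xy = ℚₚ.≰⇒> λ y≤0 →
  ℚₚ.<-irrefl refl (ℚₚ.<-≤-trans 0<xy (ℚₚ.nonPositive⁻¹ (x * y)
    {{ℚₚ.nonNeg*nonPos⇒nonPos x {{ℚ.nonNegative 0≤x}} y {{ℚ.nonPositive y≤0}}}}))

sumFin≡sum : ∀ {k} (f : Fin k → ℚ) → sumFin f ≡ sum f
sumFin≡sum {zero}  f = refl
sumFin≡sum {suc k} f = cong (f zero ℚ.+_) (sumFin≡sum (f ∘ suc))

sumFin-cong : ∀ {k} {f g : Fin k → ℚ} → (∀ x → f x ≡ g x) → sumFin f ≡ sumFin g
sumFin-cong {zero}  f≗g = refl
sumFin-cong {suc k} f≗g = cong₂ ℚ._+_ (f≗g zero) (sumFin-cong (f≗g ∘ suc))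

sumFin-zero : ∀ k → sumFin {k} (λ _ → 0ℚ) ≡ 0ℚ
sumFin-zero k = trans (sumFin≡sum {k} _) (sum-replicate-zero k)

sumFin-*ˡ : ∀ {k} c (f : Fin k → ℚ) → sumFin (λ x → c * f x) ≡ c * sumFin f
sumFin-*ˡ c f = begin
  sumFin (λ x → c * f x) ≡⟨ sumFin≡sum (λ x → c * f x) ⟩
  sum (λ x → c * f x)    ≡⟨ *-distribˡ-sum c f ⟨
  c * sum f              ≡⟨ cong (c *_) (sumFin≡sum f) ⟨
  c * sumFin f           ∎

sumFin-comm : ∀ {k l} (G : Fin k → Fin l → ℚ) →
  sumFin (λ x → sumFin (G x)) ≡ sumFin (λ y → sumFin (λ x → G x y))
sumFin-comm G = begin
  sumFin (λ x → sumFin (G x))         ≡⟨ sumFin-cong (sumFin≡sum ∘ G) ⟩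
  sumFin (λ x → sum (G x))            ≡⟨ sumFin≡sum (λ x → sum (G x)) ⟩
  sum (λ x → sum (G x))               ≡⟨ ∑-comm G ⟩
  sum (λ y → sum (λ x → G x y))       ≡⟨ sumFin≡sum (λ y → sum (λ x → G x y)) ⟨
  sumFin (λ y → sum (λ x → G x y))    ≡⟨ sumFin-cong (λ y → sumFin≡sum (λ x → G x y)) ⟨
  sumFin (λ y → sumFin (λ x → G x y)) ∎

sumFin-mono : ∀ {k} {f g : Fin k → ℚ} → (∀ x → f x ℚ.≤ g x) → sumFin f ℚ.≤ sumFin g
sumFin-mono {zero}  f≤g = ℚₚ.≤-refl
sumFin-mono {suc k} f≤g = ℚₚ.+-mono-≤ (f≤g zero) (sumFin-mono (f≤g ∘ suc))

sumFin-strict : ∀ {k} {f g : Fin k → ℚ} → (∀ x → f x ℚ.≤ g x) →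
  ∀ x → f x ℚ.< g x → sumFin f ℚ.< sumFin g
sumFin-strict {suc k} f≤g zero    f<g =
  ℚₚ.+-mono-<-≤ f<g (sumFin-mono (f≤g ∘ suc))
sumFin-strict {suc k} f≤g (suc x) f<g =
  ℚₚ.+-mono-≤-< (f≤g zero) (sumFin-strict (f≤g ∘ suc) x f<g)

sumFin-indicator : ∀ {k} (x : Fin k) (g : Fin k → ℚ) →
  sumFin (λ y → if does (x Fin.≟ y) then g y else 0ℚ) ≡ g x
sumFin-indicator {suc k} zero    g =
  trans (cong (g zero ℚ.+_) (sumFin-zero k)) (ℚₚ.+-identityʳ (g zero))
sumFin-indicator {suc k} (suc x) g =
  trans (ℚₚ.+-identityˡ _) (sumFin-indicator x (g ∘ suc))

sumFin-*-prob : ∀ {k} c (d : Dist k) → sumFin (λ x → c * prob d x) ≡ c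
sumFin-*-prob c d = begin
  sumFin (λ x → c * prob d x) ≡⟨ sumFin-*ˡ c (prob d) ⟩
  c * sumFin (prob d)         ≡⟨ cong (c *_) (total d) ⟩
  c * 1ℚ                      ≡⟨ ℚₚ.*-identityʳ c ⟩
  c                           ∎

if-comm : ∀ b c (x : ℚ) →
  (if b then (if c then x else 0ℚ) else 0ℚ) ≡ (if c then (if b then x else 0ℚ) else 0ℚ)
if-comm true  c     x = refl
if-comm false true  x = refl
if-comm false false x = refl

does-≡⇒⇔ : ∀ {A B : Set} (a? : Dec A) (b? : Dec B) → does a? ≡ does b? → A ⇔ B
does-≡⇒⇔ (yes a)  (yes b)  _ = mk⇔ (λ _ → b) (λ _ → a)
does-≡⇒⇔ (no ¬a) (no ¬b) _ = mk⇔ (λ a → contradiction a ¬a) (λ b → contradiction b ¬b)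

pigeonhole-⇔ : ∀ {k n} {P : Fin k → Fin n → Set} → (∀ x q → Dec (P x q)) →
  2 ^ n < k → ∃₂ λ x y → x Fin.< y × (∀ q → P x q ⇔ P y q)
pigeonhole-⇔ {k} {n} P? 2ⁿ<k =
  let x , y , x<y , code-x≡code-y = pigeonhole 2ⁿ<k code in
  x , y , x<y , λ q → does-≡⇒⇔ (P? x q) (P? y q) (begin
    does (P? x q)                  ≡⟨ decode-code x q ⟨
    toBool (finToFun (code x) q)   ≡⟨ cong (λ c → toBool (finToFun c q)) code-x≡code-y ⟩
    toBool (finToFun (code y) q)   ≡⟨ decode-code y q ⟩
    does (P? y q)                  ∎)
  where
    open Inverse 2↔Bool using (strictlyInverseˡ) renaming (to to toBool; from to fromBool)
    code : Fin k → Fin (2 ^ n)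
    code x = funToFin (λ q → fromBool (does (P? x q)))
    decode-code : ∀ x q → toBool (finToFun (code x) q) ≡ does (P? x q)
    decode-code x q = trans (cong toBool (finToFun-funToFin _ q)) (strictlyInverseˡ _)

Unique⇒lookup-injective : ∀ {A : Set} {xs : List A} → Unique xs →
  ∀ {x y} → List.lookup xs x ≡ List.lookup xs y → x ≡ y
Unique⇒lookup-injective (_ ∷ _) {zero} {zero} _ = refl
Unique⇒lookup-injective (x≢xs ∷ _) {zero} {suc y} e =
  contradiction e (All.lookup x≢xs (∈-lookup y))
Unique⇒lookup-injective (x≢xs ∷ _) {suc x} {zero} e =
  contradiction (sym e) (All.lookup x≢xs (∈-lookup x))
Unique⇒lookup-injective (_ ∷ unique) {suc x} {suc y} e =
  cong suc (Unique⇒lookup-injective unique e)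

module _ (M : MDP) where

  sumHist-cong : ∀ m {f g : Hist M m → ℚ} → (∀ h → f h ≡ g h) → sumHist M m f ≡ sumHist M m g
  sumHist-cong zero    f≗g = sumFin-cong f≗g
  sumHist-cong (suc m) f≗g =
    sumHist-cong m (λ h → sumFin-cong (λ a → sumFin-cong (λ q → f≗g (h , a , q))))

  sumHist-zero : ∀ m → sumHist M m (λ _ → 0ℚ) ≡ 0ℚ
  sumHist-zero zero    = sumFin-zero (nQ M)
  sumHist-zero (suc m) =
    trans (sumHist-cong m {g = λ _ → 0ℚ} (λ _ → inner-zero)) (sumHist-zero m)
    where
    inner-zero : sumFin {nA M} (λ _ → sumFin {nQ M} (λ _ → 0ℚ)) ≡ 0ℚ
    inner-zero = trans (sumFin-cong {nA M} (λ _ → sumFin-zero (nQ M))) (sumFin-zero (nA M))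

  if-sumHist : ∀ m b (f : Hist M m → ℚ) →
    (if b then sumHist M m f else 0ℚ) ≡ sumHist M m (λ h → if b then f h else 0ℚ)
  if-sumHist m true  f = refl
  if-sumHist m false f = sym (sumHist-zero m)

  sumHist-strict : ∀ m {f g : Hist M m → ℚ} → (∀ h → f h ℚ.≤ g h) →
    ∀ h → f h ℚ.< g h → sumHist M m f ℚ.< sumHist M m g
  sumHist-strict zero    f≤g h f<g = sumFin-strict f≤g h f<g
  sumHist-strict (suc m) f≤g (h , a , q) f<g =
    sumHist-strict m (λ h → sumFin-mono (λ a → sumFin-mono (λ q → f≤g (h , a , q)))) h
      (sumFin-strict (λ a → sumFin-mono (λ q → f≤g (h , a , q))) a
        (sumFin-strict (λ q → f≤g (h , a , q)) q f<g))

  sumFin-sumHist-comm : ∀ {k} m (G : Fin k → Hist M m → ℚ) →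
    sumFin (λ x → sumHist M m (G x)) ≡ sumHist M m (λ h → sumFin (λ x → G x h))
  sumFin-sumHist-comm zero    G = sumFin-comm G
  sumFin-sumHist-comm (suc m) G =
    trans (sumFin-sumHist-comm m (λ x h → sumFin (λ a → sumFin (λ q → G x (h , a , q)))))
      (sumHist-cong m (λ h →
        trans (sumFin-comm (λ x a → sumFin (λ q → G x (h , a , q))))
              (sumFin-cong (λ a → sumFin-comm (λ x q → G x (h , a , q))))))

  any-Hist? : ∀ m {P : Hist M m → Set} → (∀ h → Dec (P h)) → Dec (∃ P)
  any-Hist? zero    P? = any? P?
  any-Hist? (suc m) P? =
    map′ (λ (h , a , q , p) → (h , a , q) , p) (λ ((h , a , q) , p) → h , a , q , p)
      (any-Hist? m (λ h → any? (λ a → any? (λ q → P? (h , a , q)))))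

  constHist : ∀ m → Fin (nQ M) → Fin (nA M) → Hist M m
  constHist zero    q a = q
  constHist (suc m) q a = constHist m q a , a , q

module _ (M : MDP) (d0 : Dist (nQ M)) where

  histProb-nonNeg : ∀ σ m h → 0ℚ ℚ.≤ histProb M d0 σ m h
  histProb-nonNeg σ zero    q           = nonneg d0 q
  histProb-nonNeg σ (suc m) (h , a , q) =
    *-nonNeg (*-nonNeg (histProb-nonNeg σ m h) (nonneg (σ m h) a))
             (nonneg (δ M (last M m h) a) q)

  histProb-total : ∀ σ m → sumHist M m (histProb M d0 σ m) ≡ 1ℚ
  histProb-total σ zero    = total d0
  histProb-total σ (suc m) = trans (sumHist-cong M m one-step) (histProb-total σ m)
    where
    one-step : ∀ h → sumFin (λ a → sumFin (λ q → histProb M d0 σ (suc m) (h , a , q)))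
                     ≡ histProb M d0 σ m h
    one-step h = trans (sumFin-cong (λ a → sumFin-*-prob _ (δ M (last M m h) a)))
                       (sumFin-*-prob _ (σ m h))

  histProb-suc-pos⁻ : ∀ σ m h a q → 0ℚ ℚ.< histProb M d0 σ (suc m) (h , a , q) →
    0ℚ ℚ.< histProb M d0 σ m h × 0ℚ ℚ.< prob (σ m h) a × 0ℚ ℚ.< prob (δ M (last M m h) a) q
  histProb-suc-pos⁻ σ m h a q pos =
    *-pos⇒posˡ (nonneg (σ m h) a) pos-init ,
    *-pos⇒posʳ (histProb-nonNeg σ m h) pos-init ,
    *-pos⇒posʳ (*-nonNeg (histProb-nonNeg σ m h) (nonneg (σ m h) a)) pos
    where
    pos-init : 0ℚ ℚ.< histProb M d0 σ m h * prob (σ m h) a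
    pos-init = *-pos⇒posˡ (nonneg (δ M (last M m h) a) q) pos

  histProb-suc-pos⁺ : ∀ σ m h a q → 0ℚ ℚ.< histProb M d0 σ m h → 0ℚ ℚ.< prob (σ m h) a →
    0ℚ ℚ.< prob (δ M (last M m h) a) q → 0ℚ ℚ.< histProb M d0 σ (suc m) (h , a , q)
  histProb-suc-pos⁺ σ m h a q pos-h pos-a pos-q = *-pos (*-pos pos-h pos-a) pos-q

  Reachable : Strategy M → ℕ → Fin (nQ M) → Set
  Reachable σ m q = ∃ λ h → last M m h ≡ q × 0ℚ ℚ.< histProb M d0 σ m h

  reachable? : ∀ σ m q → Dec (Reachable σ m q)
  reachable? σ m q =
    any-Hist? M m (λ h → (last M m h Fin.≟ q) ×-dec (0ℚ ℚ.<? histProb M d0 σ m h))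

  histProbIn : Subset (nQ M) → Strategy M → ∀ m → Hist M m → ℚ
  histProbIn T σ m h = if lookup T (last M m h) then histProb M d0 σ m h else 0ℚ

  distT≡sumHist : ∀ σ m T → distT M d0 σ m T ≡ sumHist M m (histProbIn T σ m)
  distT≡sumHist σ m T = begin
    sumFin (λ q → if lookup T q then sumHist M m (at q) else 0ℚ)
      ≡⟨ sumFin-cong (λ q → if-sumHist M m (lookup T q) (at q)) ⟩
    sumFin (λ q → sumHist M m (λ h → if lookup T q then at q h else 0ℚ))
      ≡⟨ sumFin-sumHist-comm M m (λ q h → if lookup T q then at q h else 0ℚ) ⟩
    sumHist M m (λ h → sumFin (λ q → if lookup T q then at q h else 0ℚ))
      ≡⟨ sumHist-cong M m (λ h → sumFin-cong (λ q → if-comm (lookup T q) _ (p h))) ⟩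
    sumHist M m (λ h → sumFin (λ q → if does (last M m h Fin.≟ q) then p-in-T q h else 0ℚ))
      ≡⟨ sumHist-cong M m (λ h → sumFin-indicator (last M m h) (λ q → p-in-T q h)) ⟩
    sumHist M m (histProbIn T σ m) ∎
    where
    p : Hist M m → ℚ
    p = histProb M d0 σ m
    at : Fin (nQ M) → Hist M m → ℚ
    at q h = if does (last M m h Fin.≟ q) then p h else 0ℚ
    p-in-T : Fin (nQ M) → Hist M m → ℚ
    p-in-T q h = if lookup T q then p h else 0ℚ

  distT≡1⇒reachable⊆ : ∀ σ m T → distT M d0 σ m T ≡ 1ℚ →
    ∀ {q} → Reachable σ m q → lookup T q ≡ true
  distT≡1⇒reachable⊆ σ m T mass≡1 (h , refl , pos) with lookup T (last M m h) in eq
  ... | true  = refl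
  ... | false = contradiction mass<1 (ℚₚ.<-irrefl mass≡1)
    where
    in-T≤ : ∀ h′ → histProbIn T σ m h′ ℚ.≤ histProb M d0 σ m h′
    in-T≤ h′ with lookup T (last M m h′)
    ... | true  = ℚₚ.≤-refl
    ... | false = histProb-nonNeg σ m h′
    in-T<at-h : histProbIn T σ m h ℚ.< histProb M d0 σ m h
    in-T<at-h rewrite eq = pos
    mass<1 : distT M d0 σ m T ℚ.< 1ℚ
    mass<1 = subst₂ ℚ._<_ (sym (distT≡sumHist σ m T)) (histProb-total σ m)
               (sumHist-strict M m in-T≤ h in-T<at-h)

  reachable⊆⇒distT≡1 : ∀ σ m T → (∀ {q} → Reachable σ m q → lookup T q ≡ true) →
    distT M d0 σ m T ≡ 1ℚ
  reachable⊆⇒distT≡1 σ m T reachable⊆T =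
    trans (distT≡sumHist σ m T) (trans (sumHist-cong M m in-T≡) (histProb-total σ m))
    where
    in-T≡ : ∀ h → histProbIn T σ m h ≡ histProb M d0 σ m h
    in-T≡ h with lookup T (last M m h) in eq
    ... | true  = refl
    ... | false = ℚₚ.≤-antisym (histProb-nonNeg σ m h) (ℚₚ.≮⇒≥ λ pos →
                    contradiction (trans (sym (reachable⊆T (h , refl , pos))) eq) λ ())

  SureWeaklySynchronizing : Subset (nQ M) → Set
  SureWeaklySynchronizing T =
    Σ[ σ ∈ Strategy M ] (∀ (N : ℕ) → ∃[ i ] (N ≤ i × distT M d0 σ i T ≡ 1ℚ))

  module Pumping (σ : Strategy M) {i j : ℕ} (i<j : i < j)
                 (back : ∀ {q} → Reachable σ j q → Reachable σ i q) where

    tick : ℕ → ℕ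
    tick m with suc m ℕₚ.≟ j
    ... | yes _ = i
    ... | no  _ = suc m

    clock : ℕ → ℕ
    clock zero    = zero
    clock (suc k) = tick (clock k)

    tick-wrap : ∀ {m} → suc m ≡ j → tick m ≡ i
    tick-wrap {m} 1+m≡j with suc m ℕₚ.≟ j
    ... | yes _      = refl
    ... | no  1+m≢j = contradiction 1+m≡j 1+m≢j

    tick-step : ∀ {m} → suc m ≢ j → tick m ≡ suc m
    tick-step {m} 1+m≢j with suc m ℕₚ.≟ j
    ... | yes 1+m≡j = contradiction 1+m≡j 1+m≢j
    ... | no  _      = refl

    clock-< : ∀ k → clock k < j
    clock-< zero    = ℕₚ.≤-<-trans z≤n i<j
    clock-< (suc k) with suc (clock k) ℕₚ.≟ j
    ... | yes _     = i<j
    ... | no 1+c≢j = ℕₚ.≤∧≢⇒< (clock-< k) 1+c≢j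

    clock-wraps : ∀ d k → suc (d + clock k) ≡ j → clock (suc (d + k)) ≡ i
    clock-wraps zero    k 1+c≡j = tick-wrap 1+c≡j
    clock-wraps (suc d) k 2+d+c≡j =
      subst (λ t → clock (suc t) ≡ i) (ℕₚ.+-suc d k)
        (clock-wraps d (suc k) (begin
          suc (d + clock (suc k)) ≡⟨ cong (λ c → suc (d + c)) (tick-step 1+c≢j) ⟩
          suc (d + suc (clock k)) ≡⟨ cong suc (ℕₚ.+-suc d (clock k)) ⟩
          suc (suc (d + clock k)) ≡⟨ 2+d+c≡j ⟩
          j                       ∎))
      where
      1+c≢j : suc (clock k) ≢ j
      1+c≢j 1+c≡j = ℕₚ.<⇒≢ (s≤s (s≤s (ℕₚ.m≤n+m (clock k) d))) (trans 1+c≡j (sym 2+d+c≡j))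

    clock-recurrent : ∀ N → ∃[ k ] (N ≤ k × clock k ≡ i)
    clock-recurrent N =
      let d , 1+c+d≡j = ℕₚ.m≤n⇒∃[o]m+o≡n (clock-< N) in
      suc (d + N) , ℕₚ.≤-trans (ℕₚ.m≤n+m N d) (ℕₚ.n≤1+n _) ,
      clock-wraps d N (trans (cong suc (ℕₚ.+-comm d (clock N))) 1+c+d≡j)

    -- Junk fallback: by back, it only replaces histories of probability zero.
    representative : Fin (nQ M) → Fin (nA M) → Hist M i
    representative q a with reachable? σ i q
    ... | yes (h , _) = h
    ... | no  _       = constHist M i q a

    representative-reachable : ∀ {q} a → Reachable σ i q →
      last M i (representative q a) ≡ q × 0ℚ ℚ.< histProb M d0 σ i (representative q a)
    representative-reachable {q} a r with reachable? σ i q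
    ... | yes (_ , h-reaches-q) = h-reaches-q
    ... | no  ¬r                = contradiction r ¬r

    extend : ∀ m → Hist M m → Fin (nA M) → Fin (nQ M) → Hist M (tick m)
    extend m h a q with suc m ℕₚ.≟ j
    ... | yes _ = representative q a
    ... | no  _ = h , a , q

    simulate : ∀ k → Hist M k → Hist M (clock k)
    simulate zero    q           = q
    simulate (suc k) (h , a , q) = extend (clock k) (simulate k h) a q

    pumped : Strategy M
    pumped k h = σ (clock k) (simulate k h)

    extend-pos : ∀ m h a q → 0ℚ ℚ.< histProb M d0 σ (suc m) (h , a , q) →
      last M (tick m) (extend m h a q) ≡ q × 0ℚ ℚ.< histProb M d0 σ (tick m) (extend m h a q)
    extend-pos m h a q pos with suc m ℕₚ.≟ j
    ... | yes refl = representative-reachable a (back ((h , a , q) , refl , pos))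
    ... | no  _    = refl , pos

    simulate-pos : ∀ k h → 0ℚ ℚ.< histProb M d0 pumped k h →
      last M (clock k) (simulate k h) ≡ last M k h ×
      0ℚ ℚ.< histProb M d0 σ (clock k) (simulate k h)
    simulate-pos zero    q           pos = refl , pos
    simulate-pos (suc k) (h , a , q) pos =
      let pos-h , pos-a , pos-q = histProb-suc-pos⁻ pumped k h a q pos
          same-last , pos-h′    = simulate-pos k h pos-h
      in extend-pos (clock k) (simulate k h) a q
           (histProb-suc-pos⁺ σ (clock k) (simulate k h) a q pos-h′ pos-a
             (subst (λ s → 0ℚ ℚ.< prob (δ M s a) q) (sym same-last) pos-q))

    pumped-reachable : ∀ {k q} → Reachable pumped k q → Reachable σ (clock k) q
    pumped-reachable {k} (h , refl , pos) =
      let same-last , pos′ = simulate-pos k h pos in simulate k h , same-last , pos′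

  pumping : ∀ σ T {i j} → i < j → (∀ {q} → Reachable σ j q → Reachable σ i q) →
    distT M d0 σ i T ≡ 1ℚ → SureWeaklySynchronizing T
  pumping σ T {i} i<j back sync-i = pumped , λ N →
    let k , N≤k , clock-k≡i = clock-recurrent N in
    k , N≤k , reachable⊆⇒distT≡1 pumped k T λ r →
      distT≡1⇒reachable⊆ σ i T sync-i
        (subst (λ t → Reachable σ t _) clock-k≡i (pumped-reachable r))
    where open Pumping σ i<j back

  repeated-support⇒sureWeaklySynchronizing : ∀ σ T {i j} → i ≢ j →
    (∀ q → Reachable σ i q ⇔ Reachable σ j q) →
    distT M d0 σ i T ≡ 1ℚ → distT M d0 σ j T ≡ 1ℚ → SureWeaklySynchronizing T
  repeated-support⇒sureWeaklySynchronizing σ T {i} {j} i≢j same-support sync-i sync-j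
    with ℕₚ.<-cmp i j
  ... | tri< i<j _ _ = pumping σ T i<j (Equivalence.from (same-support _)) sync-i
  ... | tri≈ _ i≡j _ = contradiction i≡j i≢j
  ... | tri> _ _ j<i = pumping σ T j<i (Equivalence.to (same-support _)) sync-j

lemma4 : (M : MDP) (T : Subset (nQ M)) (d0 : Dist (nQ M)) →
    ¬ (Σ[ σ ∈ Strategy M ] (∀ (N : ℕ) → ∃[ i ] (N ≤ i × distT M d0 σ i T ≡ 1ℚ))) →
    (σ : Strategy M) (is : List ℕ) → Unique is →
    All (λ i → distT M d0 σ i T ≡ 1ℚ) is →
    length is ≤ 2 ^ nQ M
lemma4 M T d0 not-sync σ is unique all-sync = ℕₚ.≮⇒≥ λ 2ⁿ<|is| →
  let x , y , x<y , same-support =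
        pigeonhole-⇔ (λ x → reachable? M d0 σ (List.lookup is x)) 2ⁿ<|is|
  in not-sync (repeated-support⇒sureWeaklySynchronizing M d0 σ T
                 (<⇒≢ x<y ∘ Unique⇒lookup-injective unique)
                 same-support (sync-at x) (sync-at y))
  where
  sync-at : ∀ x → distT M d0 σ (List.lookup is x) T ≡ 1ℚ
  sync-at x = All.lookup all-sync (∈-lookup x)
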